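{- Let $G$ be a CGS with $G\models\varphi^{grd}$ and let $a\in\{\alpha,\beta\}$. Let $R^<_a$ be the relation on strategies of $G$ with $R^<_a(f_1,f_2)$ iff $G,\emptyset[z_1\mapsto f_1][z_2\mapsto f_2],s_0\models z_1<_a z_2$, and let $R^\equiv_a$ be the relation such that $R^\equiv_a(f_1,f_2)$ holds iff neither $R^<_a(f_1,f_2)$ nor $R^<_a(f_2,f_1)$ holds. Then $R^\equiv_a$ is an equivalence relation.
   Context: Agents $\mathrm{Ag}=\{\alpha,\beta\}$, atomic proposition $p$. A concurrent game structure (CGS) $G=(\mathrm{AP},\mathrm{Ag},\mathrm{Ac},\mathrm{St},\lambda,\tau,s_0)$ has finite non-empty sets of atomic propositions and agents, countable non-empty sets of actions and states, initial state $s_0$, labeling $\lambda$, transition function $\tau:\mathrm{St}\times\mathrm{Ac}^{\mathrm{Ag}}\to\mathrm{St}$. Strategies map tracks (finite histories of states) to actions; $\emptyset$ is the empty assignment, $\chi[z\mapsto f]$ updates an assignment. SL semantics: $\langle\langle y\rangle\rangle$/$[\![x]\!]$ quantify existentially/universally over strategies for the variable; $(a,x)$ makes agent $a$ use the strategy of $x$; temporal operators evaluated as in LTL on the unique play once all agents are bound; $G\models\varphi$ iff $\varphi$ holds at $s_0$ under $\emptyset$. Formulas: $x_1<_\alpha x_2:=\langle\langle y\rangle\rangle(\beta,y)\big((\alpha,x_1)(\mathsf{X}p)\wedge(\alpha,x_2)(\mathsf{X}\neg p)\big)$; $y_1<_\beta y_2:=\langle\langle x\rangle\rangle(\alpha,x)\big((\beta,y_1)(\mathsf{X}\neg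 p)\wedge(\beta,y_2)(\mathsf{X}p)\big)$; for $a\in\{\alpha,\beta\}$, $\varphi^{ord}_a=[\![z_1]\!]\langle\langle z_2\rangle\rangle\,z_1<_a z_2\wedge[\![z_1]\!][\![z_2]\!][\![z_3]\!]\,(z_1<_a z_2\wedge z_2<_a z_3)\rightarrow z_1<_a z_3$; $\varphi^{grd}=\varphi^{ord}_\alpha\wedge\varphi^{ord}_\beta$. -}

module Defs where

open import Data.Nat using (ℕ)
open import Data.Fin using (Fin)
open import Data.Bool using (Bool; true)
open import Data.Maybe using (Maybe; just; nothing)
open import Data.Product using (Σ; _×_; _,_)
open import Data.Sum using (_⊎_; inj₁; inj₂)
open import Data.Empty using (⊥)
open import Relation.Nullary using (¬_)
open import Relation.Binary.PropositionalEquality using (_≡_)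
open import Relation.Binary.Definitions using (DecidableEquality)
open import Relation.Nullary.Decidable using (yes; no)
open import Function.Definitions using (Injective)
open import Relation.Binary.Core using (Rel)
open import Relation.Binary.Structures using (IsEquivalence)
import Data.Nat as ℕ

data Agent : Set where
  α β : Agent

-- AP is a finite non-empty set (Fin (suc nAP)); Ac and St are countable
-- (injection into ℕ) and non-empty (witness ac₀, resp. the initial state s₀).

record CGS : Set₁ where
  field
    nAP    : ℕ
    Ac     : Set
    St     : Set
    acCode : Ac → ℕ
    acCode-inj : Injective _≡_ _≡_ acCode
    ac₀    : Ac
    stCode : St → ℕ
    stCode-inj : Injective _≡_ _≡_ stCode
    lab    : St → Fin (ℕ.suc nAP) → Bool   -- labeling λ (q ∈ λ(s) iff lab s q ≡ true)
    τ      : St → (Agent → Ac) → St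
    s₀     : St

  AP : Set
  AP = Fin (ℕ.suc nAP)

module _ (G : CGS) where
  open CGS G

  data Track : Set where
    start : St → Track
    _▷_   : Track → St → Track

  last : Track → St
  last (start s) = s
  last (h ▷ s)   = s

  Strategy : Set
  Strategy = Track → Ac

-- SL syntax (the fragment used in the paper's formulas; the only temporal
-- operator needed is X).  Variables are natural numbers.

Var : Set
Var = ℕ

data Form (G : CGS) : Set where
  atom  : CGS.AP G → Form G
  ¬'_   : Form G → Form G
  _∧'_  : Form G → Form G → Form G
  _⇒'_  : Form G → Form G → Form G
  ⟨⟨_⟩⟩_ : Var → Form G → Form G
  ⟦_⟧_   : Var → Form G → Form G
  bind  : Agent → Var → Form G → Form G
  X'_   : Form G → Form G

_≟A_ : DecidableEquality Agent
α ≟A α = yes Relation.Binary.PropositionalEquality.refl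
α ≟A β = no λ ()
β ≟A α = no λ ()
β ≟A β = yes Relation.Binary.PropositionalEquality.refl

module _ (G : CGS) where
  open CGS G

  Assignment : Set
  Assignment = (Var ⊎ Agent) → Maybe (Strategy G)

  ∅ : Assignment
  ∅ _ = nothing

  _[_↦_] : Assignment → Var ⊎ Agent → Strategy G → Assignment
  (χ [ inj₁ x ↦ f ]) (inj₁ y) with x ℕ.≟ y
  ... | yes _ = just f
  ... | no  _ = χ (inj₁ y)
  (χ [ inj₁ x ↦ f ]) (inj₂ b) = χ (inj₂ b)
  (χ [ inj₂ a ↦ f ]) (inj₁ y) = χ (inj₁ y)
  (χ [ inj₂ a ↦ f ]) (inj₂ b) with a ≟A b
  ... | yes _ = just f
  ... | no  _ = χ (inj₂ b)

  profile : Strategy G → Strategy G → Track G → (Agent → Ac)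
  profile fα fβ h α = fα h
  profile fα fβ h β = fβ h

  -- Satisfaction  G, χ, h ⊨ φ  (h the current track; the paper's
  -- G, χ, s₀ ⊨ φ is the case h = start s₀).
  Sat : Assignment → Track G → Form G → Set
  Sat χ h (atom q)     = lab (last G h) q ≡ true
  Sat χ h (¬' φ)       = ¬ Sat χ h φ
  Sat χ h (φ ∧' ψ)     = Sat χ h φ × Sat χ h ψ
  Sat χ h (φ ⇒' ψ)     = Sat χ h φ → Sat χ h ψ
  Sat χ h (⟨⟨ x ⟩⟩ φ)  = Σ (Strategy G) λ f → Sat (χ [ inj₁ x ↦ f ]) h φ
  Sat χ h (⟦ x ⟧ φ)    = (f : Strategy G) → Sat (χ [ inj₁ x ↦ f ]) h φ
  Sat χ h (bind a x φ) with χ (inj₁ x)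
  ... | just f  = Sat (χ [ inj₂ a ↦ f ]) h φ
  ... | nothing = ⊥
  Sat χ h (X' φ) with χ (inj₂ α) | χ (inj₂ β)
  ... | just fα | just fβ = Sat χ (h ▷ τ (last G h) (profile fα fβ h)) φ
  ... | _       | _       = ⊥

  Models : Form G → Set
  Models φ = Sat ∅ (start s₀) φ

module _ {G : CGS} (p : CGS.AP G) where

  yv xv z₁ z₂ z₃ : Var
  yv = 0
  xv = 0
  z₁ = 1
  z₂ = 2
  z₃ = 3

  _<[_]_ : Var → Agent → Var → Form G
  x₁ <[ α ] x₂ = ⟨⟨ yv ⟩⟩ bind β yv (bind α x₁ (X' atom p) ∧' bind α x₂ (X' (¬' atom p)))
  y₁ <[ β ] y₂ = ⟨⟨ xv ⟩⟩ bind α xv (bind β y₁ (X' (¬' atom p)) ∧' bind β y₂ (X' atom p))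

  φord : Agent → Form G
  φord a = (⟦ z₁ ⟧ ⟨⟨ z₂ ⟩⟩ (z₁ <[ a ] z₂))
        ∧' (⟦ z₁ ⟧ ⟦ z₂ ⟧ ⟦ z₃ ⟧ (((z₁ <[ a ] z₂) ∧' (z₂ <[ a ] z₃)) ⇒' (z₁ <[ a ] z₃)))

  φgrd : Form G
  φgrd = φord α ∧' φord β

  R< : Agent → Rel (Strategy G) _
  R< a f₁ f₂ = Sat G (_[_↦_] G (_[_↦_] G (∅ G) (inj₁ z₁) f₁) (inj₁ z₂) f₂) (start (CGS.s₀ G)) (z₁ <[ a ] z₂)

  R≡ : Agent → Rel (Strategy G) _
  R≡ a f₁ f₂ = ¬ R< a f₁ f₂ × ¬ R< a f₂ f₁

module Submission where

open import Defs
open import Data.Bool using (true; _≟_)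
open import Data.Product using (_×_; _,_; swap)
open import Data.Sum using (inj₁; inj₂)
open import Relation.Nullary using (¬_; yes; no)
open import Relation.Unary using (Pred; Decidable)
open import Relation.Binary.Core using (Rel)
open import Relation.Binary.Definitions using (Irreflexive; Cotransitive)
open import Relation.Binary.Structures using (IsEquivalence)
open import Relation.Binary.Consequences using (cotrans⇒¬-trans)
open import Relation.Binary.PropositionalEquality using (_≡_; refl)

-- R<_a is the strict part of a weak order: a witness of f₁ < f₂ is an opponent
-- strategy separating f₁ and f₂ on p at the first step, and any third strategy
-- falls on one side of that separation (cotransitivity).  Incomparability with
-- respect to an irreflexive cotransitive relation is always an equivalence.

incomparable-isEquivalence : ∀ {a ℓ} {A : Set a} {_<_ : Rel A ℓ} →
                             Irreflexive _≡_ _<_ → Cotransitive _<_ →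
                             IsEquivalence (λ x y → ¬ x < y × ¬ y < x)
incomparable-isEquivalence {_<_ = _<_} irrefl cotrans = record
  { refl  = irrefl refl , irrefl refl
  ; sym   = swap
  ; trans = λ (x≮y , y≮x) (y≮z , z≮y) → ≮-trans x≮y y≮z , ≮-trans z≮y y≮x
  }
  where
  ≮-trans = cotrans⇒¬-trans {_∼_ = _<_} cotrans

module _ (G : CGS) (p : CGS.AP G) where
  open CGS G

  next : Strategy G → Strategy G → St
  next fα fβ = τ s₀ (profile G fα fβ (start s₀))

  Holds-p : Pred St _
  Holds-p s = lab s p ≡ true

  holds-p? : Decidable Holds-p
  holds-p? s = lab s p ≟ true

  R<-irrefl : ∀ a → Irreflexive _≡_ (R< {G} p a)
  R<-irrefl α refl (_ , p₁ , ¬p₁) = ¬p₁ p₁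
  R<-irrefl β refl (_ , ¬p₁ , p₁) = ¬p₁ p₁

  R<-cotrans : ∀ a → Cotransitive (R< {G} p a)
  R<-cotrans α (y , p₁ , ¬p₂) f₃ with holds-p? (next f₃ y)
  ... | yes p₃ = inj₂ (y , p₃ , ¬p₂)
  ... | no ¬p₃ = inj₁ (y , p₁ , ¬p₃)
  R<-cotrans β (x , ¬p₁ , p₂) f₃ with holds-p? (next x f₃)
  ... | yes p₃ = inj₁ (x , ¬p₁ , p₃)
  ... | no ¬p₃ = inj₂ (x , ¬p₃ , p₂)

lemma3p8 : (G : CGS) (p : CGS.AP G) → Models G (φgrd p) → (a : Agent) → IsEquivalence (R≡ {G} p a)
lemma3p8 G p _ a = incomparable-isEquivalence (R<-irrefl G p a) (R<-cotrans G p a)
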